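{- For partial orders $\langle R,X\rangle$ and $\langle S,Y\rangle$ with $X\cap Y=\emptyset$, $L(\langle R,X\rangle\cdot\langle S,Y\rangle)=L\langle R,X\rangle\cdot L\langle S,Y\rangle$, where the $\cdot$ on the right is the (linear-order) concatenation product.
   Context: A relation on $X$ is a pair $\langle R,X\rangle$ with $R\subseteq X^2$. For $X\cap Y=\emptyset$, $\langle R,X\rangle\cdot\langle S,Y\rangle=\langle R\cup S\cup(X\times Y),X\cup Y\rangle$. Partial orders are strict (irreflexive and transitive); a linear order is a partial order in which any two distinct elements are comparable. A relationship on $X$ is a pair $[U,X]$ with $U\subseteq\mathcal P(X^2)$. For a partial order $\langle R,X\rangle$, $L\langle R,X\rangle=[\{R'\subseteq X^2\mid R\subseteq R',\ \langle R',X\rangle\text{ a linear order}\},X]$. For relationships $[U,X],[V,Y]$ with $X\cap Y=\emptyset$, the concatenation product is $[U,X]\cdot[V,Y]=[\{Q\subseteq(X\cup Y)^2\mid \langle Q,X\cup Y\rangle\text{ is a linear order and }\exists R\in U\,\exists S\in V\ \langle Q,X\cup Y\rangle=\langle R,X\rangle\cdot\langle S,Y\rangle\},X\cup Y]$. -}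

module Defs where

open import Level using (0ℓ; suc; Lift)
open import Data.Product using (Σ; ∃; ∃-syntax; _×_; _,_)
open import Data.Sum using (_⊎_)
open import Data.Empty using (⊥)
open import Relation.Nullary using (¬_)
open import Relation.Binary.PropositionalEquality using (_≡_; _≢_)
open import Function.Bundles using (_⇔_)

Subset : Set → Set₁
Subset A = A → Set

BinRel : Set → Set₁
BinRel A = A → A → Set

module _ {A : Set} where

  _∪ˢ_ : Subset A → Subset A → Subset A
  (X ∪ˢ Y) a = X a ⊎ Y a

  Disjoint : Subset A → Subset A → Set
  Disjoint X Y = ∀ a → X a → Y a → ⊥

  IsRelOn : BinRel A → Subset A → Set
  IsRelOn R X = ∀ a b → R a b → X a × X b

  _⊆ᴿ_ : BinRel A → BinRel A → Set
  R ⊆ᴿ R' = ∀ a b → R a b → R' a b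

  _≐ᴿ_ : BinRel A → BinRel A → Set
  R ≐ᴿ R' = ∀ a b → R a b ⇔ R' a b

  IsPartialOrder : BinRel A → Subset A → Set
  IsPartialOrder R X =
    IsRelOn R X × (∀ a → ¬ R a a) × (∀ a b c → R a b → R b c → R a c)

  IsLinearOrder : BinRel A → Subset A → Set
  IsLinearOrder R X =
    IsPartialOrder R X × (∀ a b → X a → X b → a ≢ b → R a b ⊎ R b a)

  _·ᴿ_ : (BinRel A × Subset A) → (BinRel A × Subset A) → BinRel A
  ((R , X) ·ᴿ (S , Y)) a b = R a b ⊎ S a b ⊎ (X a × Y b)

  -- a relationship [U,X] : U ⊆ P(X²), represented as a predicate on relations
  Relationship : Set₂
  Relationship = (BinRel A → Set₁) × Subset A

  L : BinRel A → Subset A → Relationship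
  L R X = (λ R' → Lift (suc 0ℓ) (IsRelOn R' X × R ⊆ᴿ R' × IsLinearOrder R' X)) , X

  _·_ : Relationship → Relationship → Relationship
  (U , X) · (V , Y) =
    (λ Q → Lift (suc 0ℓ) (IsRelOn Q (X ∪ˢ Y) × IsLinearOrder Q (X ∪ˢ Y)) ×
           (∃[ R ] ∃[ S ] (U R × V S × Q ≐ᴿ ((R , X) ·ᴿ (S , Y)))))
    , (X ∪ˢ Y)

  _≈_ : Relationship → Relationship → Set₁
  (U , X) ≈ (V , Y) = Lift (suc 0ℓ) (∀ a → X a ⇔ Y a) × (∀ Q → U Q ⇔ V Q)

module Submission where

-- (⊆) Given a linear extension Q of R·S, restrict it to X and to Y.  The
--     restriction of a linear order to a subset of its carrier is a linear
--     order on that subset, and it still extends R (resp. S).  Since Q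
--     contains X × Y and is irreflexive and transitive it can contain no
--     pair from Y × X, so Q splits as (Q↾X)·(Q↾Y).
-- (⊇) If Q equals R'·S' with R ⊆ R' and S ⊆ S', then Q ⊇ R·S because the
--     product of relations is monotone in both factors; linearity of Q is
--     part of the hypothesis.

open import Defs
open import Data.Product using (_×_; _,_; proj₁; proj₂)
open import Data.Sum using (_⊎_; inj₁; inj₂)
open import Relation.Binary.PropositionalEquality using (_≢_)
open import Data.Empty using (⊥-elim)
open import Level using (lift)
open import Function.Bundles using (mk⇔; Equivalence)

module _ {A : Set} where

  _⊆ˢ_ : Subset A → Subset A → Set
  X ⊆ˢ Z = ∀ a → X a → Z a

  _↾_ : BinRel A → Subset A → BinRel A
  (Q ↾ X) a b = Q a b × X a × X b

  restrict-isRelOn : (Q : BinRel A) (X : Subset A) → IsRelOn (Q ↾ X) X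
  restrict-isRelOn Q X a b (_ , xa , xb) = xa , xb

  restrict-⊆ : {R Q : BinRel A} {X : Subset A} →
    IsRelOn R X → R ⊆ᴿ Q → R ⊆ᴿ (Q ↾ X)
  restrict-⊆ relR R⊆Q a b r = R⊆Q a b r , relR a b r

  restrict-partialOrder : {Q : BinRel A} {Z : Subset A} (X : Subset A) →
    IsPartialOrder Q Z → IsPartialOrder (Q ↾ X) X
  restrict-partialOrder {Q} X (_ , irr , trans) =
    restrict-isRelOn Q X ,
    (λ a q → irr a (proj₁ q)) ,
    (λ a b c (qab , xa , _) (qbc , _ , xc) → trans a b c qab qbc , xa , xc)

  restrict-linearOrder : {Q : BinRel A} {Z X : Subset A} →
    X ⊆ˢ Z → IsLinearOrder Q Z → IsLinearOrder (Q ↾ X) X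
  restrict-linearOrder {Q} {X = X} X⊆Z (po , total) =
    restrict-partialOrder X po , total↾
    where
    total↾ : ∀ a b → X a → X b → a ≢ b → (Q ↾ X) a b ⊎ (Q ↾ X) b a
    total↾ a b xa xb a≢b with total a b (X⊆Z a xa) (X⊆Z b xb) a≢b
    ... | inj₁ qab = inj₁ (qab , xa , xb)
    ... | inj₂ qba = inj₂ (qba , xb , xa)

  restrict-linearExtension : {R Q : BinRel A} {Z X : Subset A} →
    X ⊆ˢ Z → IsRelOn R X → R ⊆ᴿ Q → IsLinearOrder Q Z →
    proj₁ (L R X) (Q ↾ X)
  restrict-linearExtension {Q = Q} {X = X} X⊆Z relR R⊆Q lin =
    lift (restrict-isRelOn Q X , restrict-⊆ relR R⊆Q , restrict-linearOrder X⊆Z lin)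

  -- A partial order on X ∪ Y that contains X × Y is the product of its
  -- restrictions to X and to Y: a pair from Y × X would, together with the
  -- reverse pair from X × Y, contradict irreflexivity.
  split-product : {Q : BinRel A} {X Y : Subset A} →
    IsPartialOrder Q (X ∪ˢ Y) → (∀ a b → X a → Y b → Q a b) →
    Q ≐ᴿ ((Q ↾ X , X) ·ᴿ (Q ↾ Y , Y))
  split-product {Q} {X} {Y} (relQ , irr , trans) X×Y⊆Q a b =
    mk⇔ (λ q → split (relQ a b q) q) merge
    where
    split : (X ∪ˢ Y) a × (X ∪ˢ Y) b → Q a b → ((Q ↾ X , X) ·ᴿ (Q ↾ Y , Y)) a b
    split (inj₁ xa , inj₁ xb) q = inj₁ (q , xa , xb)
    split (inj₂ ya , inj₂ yb) q = inj₂ (inj₁ (q , ya , yb))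
    split (inj₁ xa , inj₂ yb) q = inj₂ (inj₂ (xa , yb))
    split (inj₂ ya , inj₁ xb) q = ⊥-elim (irr a (trans a b a q (X×Y⊆Q b a xb ya)))
    merge : ((Q ↾ X , X) ·ᴿ (Q ↾ Y , Y)) a b → Q a b
    merge (inj₁ (q , _)) = q
    merge (inj₂ (inj₁ (q , _))) = q
    merge (inj₂ (inj₂ (xa , yb))) = X×Y⊆Q a b xa yb

  product-mono : {R R' S S' : BinRel A} {X Y : Subset A} →
    R ⊆ᴿ R' → S ⊆ᴿ S' → ((R , X) ·ᴿ (S , Y)) ⊆ᴿ ((R' , X) ·ᴿ (S' , Y))
  product-mono R⊆R' S⊆S' a b (inj₁ r) = inj₁ (R⊆R' a b r)
  product-mono R⊆R' S⊆S' a b (inj₂ (inj₁ s)) = inj₂ (inj₁ (S⊆S' a b s))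
  product-mono R⊆R' S⊆S' a b (inj₂ (inj₂ xy)) = inj₂ (inj₂ xy)

proposition4p8 : {A : Set} (R S : BinRel A) (X Y : Subset A) →
    Disjoint X Y → IsPartialOrder R X → IsPartialOrder S Y →
    L ((R , X) ·ᴿ (S , Y)) (X ∪ˢ Y) ≈ (L R X · L S Y)
proposition4p8 R S X Y _ (relR , _) (relS , _) =
  lift (λ _ → mk⇔ (λ z → z) (λ z → z)) ,
  λ Q → mk⇔ (extension⇒product Q) (product⇒extension Q)
  where
  extension⇒product : ∀ Q → proj₁ (L ((R , X) ·ᴿ (S , Y)) (X ∪ˢ Y)) Q → proj₁ (L R X · L S Y) Q
  extension⇒product Q (lift (relQ , R·S⊆Q , lin)) =
    lift (relQ , lin) , Q ↾ X , Q ↾ Y ,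
    restrict-linearExtension (λ _ → inj₁) relR (λ a b r → R·S⊆Q a b (inj₁ r)) lin ,
    restrict-linearExtension (λ _ → inj₂) relS (λ a b s → R·S⊆Q a b (inj₂ (inj₁ s))) lin ,
    split-product (proj₁ lin) (λ a b xa yb → R·S⊆Q a b (inj₂ (inj₂ (xa , yb))))

  product⇒extension : ∀ Q → proj₁ (L R X · L S Y) Q → proj₁ (L ((R , X) ·ᴿ (S , Y)) (X ∪ˢ Y)) Q
  product⇒extension Q (lift (relQ , lin) , R' , S' , lift (_ , R⊆R' , _) , lift (_ , S⊆S' , _) , Q≐R'·S') =
    lift (relQ , R·S⊆Q , lin)
    where
    R·S⊆Q : ((R , X) ·ᴿ (S , Y)) ⊆ᴿ Q
    R·S⊆Q a b p = Equivalence.from (Q≐R'·S' a b) (product-mono {X = X} {Y = Y} R⊆R' S⊆S' a b p)
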